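{- Let $G$ be a finite bipartite graph and $\{C,H\}$ a decomposition of $G$ such that $V(C)\cap V(H)=[n]=\{1,\dots,n\}$, all vertices of $[n]$ lie in the same bipartite class of $G$, every vertex of $[n]$ is 2-layered in $G$, and every vertex of $[n]$ has at least one neighbour in $C$ and at least one neighbour in $H$. Let $b\in V(C\setminus[n])$ and $a\in[n]$. Then \[ w_G=\sum_{\Theta\subseteq[n]}\sum_{\Gamma\subseteq\Theta^{\mathsf{c}}}\Big\{w_{C\setminus\Gamma}\big(\Theta,\overline{\Theta^{\mathsf{c}}\cup N_C(\Gamma)}\big)\sum_{\Psi\subseteq\Theta^{\mathsf{c}}\setminus\Gamma}w_{H\setminus\Psi}\big(\Theta,\overline{\Theta^{\mathsf{c}}\cup N_H(\Psi)}\big)\Big\},\] \[ w_G(b)=\sum_{\Theta\subseteq[n]}\sum_{\Gamma\subseteq\Theta^{\mathsf{c}}}\Big\{w_{C\setminus\Gamma}\big(\{b\}\cup\Theta,\overline{\Theta^{\mathsf{c}}\cup N_C(\Gamma)}\big)\sum_{\Psi\subseteq\Theta^{\mathsf{c}}\setminus\Gamma}w_{H\setminus\Psi}\big(\Theta,\overline{\Theta^{\mathsf{c}}\cup N_H(\Psi)}\big)\Big\},\] \[ w_G(a)=\sum_{\Theta\subseteq[n]}\sum_{\Gamma\subseteq\Theta^{\mathsf{c}}}\Big\{w_{C\setminus\Gamma}\big(\{a\}\cup\Theta,\overline{\Theta^{\mathsf{c}}\cup N_C(\Gamma)}\big)\sum_{\Psi\subseteq\Theta^{\mathsf{c}}\setminus\Gamma}w_{H\setminus\Psi}\big(\{a\}\cup\Theta,\overline{\Theta^{\mathsf{c}}\cup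 N_H(\Psi)}\big)\Big\}.\]
   Context: A stable set of a graph is a set of pairwise non-adjacent vertices; it is maximal if no further vertex can be added while keeping it stable. $w_G$ is the number of maximal stable sets of $G$ and $w_G(x)$ the number of those containing the vertex $x$. A decomposition of $G$ is a set of pairwise edge-disjoint subgraphs whose union (of vertex sets and edge sets) is $G$. A pendant vertex is a vertex of degree $1$ in $G$; a vertex $v$ is 2-layered in $G$ if every neighbour of $v$ in $G$ is adjacent to a pendant vertex of $G$. For $\Theta\subseteq[n]$, $\Theta^{\mathsf{c}}=[n]\setminus\Theta$. For a subgraph $K$ of $G$ and a vertex set $\Gamma$, $K\setminus\Gamma$ is the graph obtained from $K$ by deleting the vertices of $\Gamma$; $N_K(P)$ is the set of vertices adjacent in $K$ to some vertex of $P$. For vertex sets $P,Q$, $w_K(P,\overline{Q})$ is the number of maximal stable sets of $K$ that contain every vertex of $P$ and no vertex of $Q$. -}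

module Defs where

open import Data.Nat using (ℕ; zero; suc; _+_; _*_)
open import Data.Bool using (Bool; true; false; _∧_; _∨_; not; T; if_then_else_)
open import Data.Fin using (Fin; _≟_)
open import Data.Fin.Subset using (Subset; ⁅_⁆; ∁; _∩_; _∪_; ⊥)
open import Data.Vec using (Vec; []; _∷_; lookup)
open import Data.List using (List; []; _∷_; length; filterᵇ; map; concatMap; allFin)
open import Data.Bool.ListAction using (all; any)
open import Data.Nat.ListAction using (sum)
open import Data.Empty renaming (⊥ to Empty)
open import Relation.Nullary.Decidable using (⌊_⌋)
open import Relation.Binary.PropositionalEquality using (_≡_)
open import Data.Product using (_×_; Σ; ∃)

_∈ᵇ_ : ∀ {m} → Fin m → Subset m → Bool
x ∈ᵇ S = lookup S x

∀ᵇ : ∀ {m} → (Fin m → Bool) → Bool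
∀ᵇ {m} p = all p (allFin m)

∃ᵇ : ∀ {m} → (Fin m → Bool) → Bool
∃ᵇ {m} p = any p (allFin m)

_⊆ᵇ_ : ∀ {m} → Subset m → Subset m → Bool
S ⊆ᵇ R = ∀ᵇ (λ x → not (x ∈ᵇ S) ∨ (x ∈ᵇ R))

_∖_ : ∀ {m} → Subset m → Subset m → Subset m
S ∖ R = S ∩ ∁ R

allSubsets : (m : ℕ) → List (Subset m)
allSubsets zero = [] ∷ []
allSubsets (suc m) = concatMap (λ v → (false ∷ v) ∷ (true ∷ v) ∷ []) (allSubsets m)

ΣSub : ∀ {m} → Subset m → (Subset m → ℕ) → ℕ
ΣSub {m} X f = sum (map f (filterᵇ (λ S → S ⊆ᵇ X) (allSubsets m)))

record Graph (m : ℕ) : Set where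
  field
    V : Subset m
    E : Fin m → Fin m → Bool
open Graph public

record IsSimpleGraph {m : ℕ} (K : Graph m) : Set where
  field
    edge-ends : ∀ x y → T (E K x y) → T (x ∈ᵇ V K) × T (y ∈ᵇ V K)
    symmetric : ∀ x y → E K x y ≡ E K y x
    loopless  : ∀ x → E K x x ≡ false

BipartiteWithClass : ∀ {m} → Graph m → Subset m → Set
BipartiteWithClass {m} G I =
  Σ (Fin m → Bool) λ c →
    (∀ x y → T (E G x y) → T (not (c x ≡ᵇ' c y)))
    × (∀ x y → T (x ∈ᵇ I) → T (y ∈ᵇ I) → c x ≡ c y)
  where
    _≡ᵇ'_ : Bool → Bool → Bool
    true  ≡ᵇ' b = b
    false ≡ᵇ' b = not b

IsDecomposition : ∀ {m} → Graph m → Graph m → Graph m → Set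
IsDecomposition G C H =
    (∀ x → (x ∈ᵇ V G) ≡ ((x ∈ᵇ V C) ∨ (x ∈ᵇ V H)))
  × (∀ x y → E G x y ≡ (E C x y ∨ E H x y))
  × (∀ x y → T (E C x y) → T (E H x y) → Empty)

common : ∀ {m} → Graph m → Graph m → Subset m
common C H = V C ∩ V H

degree : ∀ {m} → Graph m → Fin m → ℕ
degree {m} K v = length (filterᵇ (λ u → E K v u) (allFin m))

Pendant : ∀ {m} → Graph m → Fin m → Set
Pendant K p = T (p ∈ᵇ V K) × degree K p ≡ 1

TwoLayered : ∀ {m} → Graph m → Fin m → Set
TwoLayered {m} K v = ∀ u → T (E K v u) → ∃ λ p → Pendant K p × T (E K u p)

_∖ᵛ_ : ∀ {m} → Graph m → Subset m → Graph m
K ∖ᵛ Γ = record { V = V K ∖ Γ ; E = λ x y → E K x y ∧ not (x ∈ᵇ Γ) ∧ not (y ∈ᵇ Γ) }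

N : ∀ {m} → Graph m → Subset m → Subset m
N {m} K P = tab λ x → ∃ᵇ (λ u → (u ∈ᵇ P) ∧ E K u x)
  where tab = Data.Vec.tabulate

isStable : ∀ {m} → Graph m → Subset m → Bool
isStable K S = (S ⊆ᵇ V K) ∧ ∀ᵇ (λ x → ∀ᵇ (λ y → not ((x ∈ᵇ S) ∧ (y ∈ᵇ S) ∧ E K x y)))

isMaximalStable : ∀ {m} → Graph m → Subset m → Bool
isMaximalStable K S =
  isStable K S ∧ ∀ᵇ (λ v → not ((v ∈ᵇ V K) ∧ not (v ∈ᵇ S)) ∨ not (isStable K (S ∪ ⁅ v ⁆)))

-- w_K(P, \overline{Q}): number of maximal stable sets of K containing P and disjoint from Q.
w[_] : ∀ {m} → Graph m → Subset m → Subset m → ℕ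
w[_] {m} K P Q =
  length (filterᵇ (λ S → isMaximalStable K S ∧ (P ⊆ᵇ S) ∧ ((S ∩ Q) ⊆ᵇ ⊥)) (allSubsets m))

wAll : ∀ {m} → Graph m → ℕ
wAll K = w[ K ] ⊥ ⊥

wAt : ∀ {m} → Graph m → Fin m → ℕ
wAt K x = w[ K ] ⁅ x ⁆ ⊥

-- The right-hand side pattern of Lemma 3.5, with the extra C-side set XC and H-side set XH
-- (X ∪ Θ is used as the required set).
rhs : ∀ {m} → Graph m → Graph m → Subset m → Subset m → ℕ
rhs C H XC XH =
  let I = common C H in
  ΣSub I λ Θ →
  ΣSub (I ∖ Θ) λ Γ →
    w[ C ∖ᵛ Γ ] (XC ∪ Θ) ((I ∖ Θ) ∪ N C Γ)
    * ΣSub ((I ∖ Θ) ∖ Γ) (λ Ψ → w[ H ∖ᵛ Ψ ] (XH ∪ Θ) ((I ∖ Θ) ∪ N H Ψ))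

-- A maximal stable set S of G = C ∪ H is the union of its traces S ∩ V(C) and S ∩ V(H), which meet in
-- Θ = S ∩ [n]. Every vertex of [n] ∖ S is dominated by S through C or through H; let Γ (resp. Ψ) be those
-- with no C-neighbour (resp. H-neighbour) in S, so Γ ∩ Ψ = ∅. Then S ∩ V(C) is a maximal stable set of
-- C ∖ Γ containing Θ and avoiding ([n] ∖ Θ) ∪ N_C(Γ), symmetrically for H, and conversely any such data
-- glue to the maximal stable set S_C ∪ S_H of G. So S ↦ (Θ, Γ, S ∩ V(C), Ψ, S ∩ V(H)) is a bijection
-- onto the tuples counted by the right-hand side. The three identities are the cases where the prescribed
-- vertices are ∅, {b} ⊆ V(C) and {a} ⊆ V(C) ∩ V(H).

module Submission where

open import Defs
open import Data.Bool using (Bool; true; false; _∧_; _∨_; not; T)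
open import Data.Bool.Properties using (T-∧; T-∨; T-≡; ∧-comm; ∨-comm) renaming (_≟_ to _≟-Bool_)
open import Data.Empty using () renaming (⊥-elim to contradiction⊥)
open import Data.Fin using (Fin)
open import Data.Fin.Subset using (Subset; _∈_; _∉_; _⊆_; _∩_; _∪_; ∁; ⁅_⁆; ⊥)
open import Data.Fin.Subset.Properties
  using ( ⊆-antisym; ⊥⊆; ∩⇔×; ∪⇔⊎; ∪-identityʳ; ∪-idem; x∈p∩q⁺; x∈p∩q⁻; x∈p∪q⁺; x∈p∪q⁻
        ; x∈∁p⇒x∉p; x∉p⇒x∈∁p; ∉⊥; _∈?_; x∈⁅x⁆; x∈⁅y⁆⇒x≡y)
open import Data.List using (List; []; _∷_; _++_; length; map; filterᵇ; cartesianProduct; concatMap; allFin)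
open import Data.List.Membership.Propositional using (lose)
open import Data.List.Membership.Propositional.Properties using (∈-allFin)
open import Data.List.Properties using (filter-++; length-++; cartesianProductWith-zeroʳ; map-cong)
import Data.List.Relation.Unary.All as All
open import Data.List.Relation.Unary.All.Properties using (all⁺; all⁻)
open import Data.List.Relation.Unary.Any using (satisfied)
open import Data.List.Relation.Unary.Any.Properties using (any⁺; any⁻)
open import Data.Nat using (ℕ; zero; suc; _+_; _*_)
open import Data.Nat.ListAction using (sum)
open import Data.Nat.Properties using (+-assoc; *-identityʳ; +-identityʳ; +-commutativeSemigroup)
open import Algebra.Properties.CommutativeSemigroup +-commutativeSemigroup using (interchange)
open import Data.Product using (_×_; _,_; proj₁; proj₂; swap; ∃)
open import Data.Product.Properties using (,-injective) renaming (≡-dec to ×-≡-dec)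
open import Data.Sum using (_⊎_; inj₁; inj₂)
import Data.Sum as Sum
open import Data.Vec using ([]; _∷_)
open import Data.Vec.Properties using (lookup⇒[]=; []=⇒lookup; lookup∘tabulate) renaming (≡-dec to Vec-≡-dec)
open import Function using (_∘_; _⇔_; mk⇔; Equivalence)
open Equivalence using (to; from)
open import Relation.Binary.Definitions using (DecidableEquality)
open import Relation.Binary.PropositionalEquality using (_≡_; refl; sym; trans; subst; cong; cong₂)
open Relation.Binary.PropositionalEquality.≡-Reasoning
open import Relation.Nullary using (¬_; yes; no)
open import Relation.Nullary.Decidable using (does; does-⇔; decidable-stable; _×-dec_; T?)

private variable
  A B : Set
  m : ℕ

count : (A → Bool) → List A → ℕ
count p xs = length (filterᵇ p xs)

count-++ : ∀ (p : A → Bool) xs ys → count p (xs ++ ys) ≡ count p xs + count p ys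
count-++ p xs ys = trans (cong length (filter-++ (T? ∘ p) xs ys)) (length-++ (filterᵇ p xs))

count-cong : ∀ {p q : A → Bool} → (∀ x → p x ≡ q x) → ∀ xs → count p xs ≡ count q xs
count-cong p≗q [] = refl
count-cong {p = p} {q} p≗q (x ∷ xs) with p x | q x | p≗q x
... | true  | true  | refl = cong suc (count-cong p≗q xs)
... | false | false | refl = count-cong p≗q xs

count-false : ∀ (xs : List A) → count (λ _ → false) xs ≡ 0
count-false [] = refl
count-false (x ∷ xs) = count-false xs

count-singleton : ∀ (p : A → Bool) (q : B → Bool) x y → p x ≡ q y → count p (x ∷ []) ≡ count q (y ∷ [])
count-singleton p q x y px≡qy with p x | q y | px≡qy
... | true  | true  | refl = refl
... | false | false | refl = refl

sum-map-const : ∀ {f : A → ℕ} {c} → (∀ x → f x ≡ c) → ∀ xs → sum (map f xs) ≡ length xs * c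
sum-map-const f≗c [] = refl
sum-map-const f≗c (x ∷ xs) = cong₂ _+_ (f≗c x) (sum-map-const f≗c xs)

count-map : ∀ (p : B → Bool) (f : A → B) xs → count p (map f xs) ≡ count (p ∘ f) xs
count-map p f [] = refl
count-map p f (x ∷ xs) with p (f x)
... | true  = cong suc (count-map p f xs)
... | false = count-map p f xs

sum-count-filterᵇ : ∀ (p : A → Bool) (q : A → B → Bool) xs ys →
  sum (map (λ x → count (q x) ys) (filterᵇ p xs)) ≡ count (λ (x , y) → p x ∧ q x y) (cartesianProduct xs ys)
sum-count-filterᵇ p q [] ys = refl
sum-count-filterᵇ {A = A} {B = B} p q (x ∷ xs) ys = begin
  sum (map (λ x → count (q x) ys) (filterᵇ p (x ∷ xs)))                      ≡⟨ split-head ⟩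
  count (λ y → p x ∧ q x y) ys + sum (map (λ x → count (q x) ys) (filterᵇ p xs))
    ≡⟨ cong₂ _+_ (sym (count-map r (x ,_) ys)) (sum-count-filterᵇ p q xs ys) ⟩
  count r (map (x ,_) ys) + count r (cartesianProduct xs ys)                 ≡⟨ count-++ r (map (x ,_) ys) _ ⟨
  count r (cartesianProduct (x ∷ xs) ys)                                     ∎
  where
  r : A × B → Bool
  r (x , y) = p x ∧ q x y
  split-head : sum (map (λ x → count (q x) ys) (filterᵇ p (x ∷ xs)))
             ≡ count (λ y → p x ∧ q x y) ys + sum (map (λ x → count (q x) ys) (filterᵇ p xs))
  split-head with p x
  ... | true  = refl
  ... | false = cong (_+ sum (map (λ x → count (q x) ys) (filterᵇ p xs))) (sym (count-false ys))

count-* : ∀ (p : A → Bool) (q : B → Bool) xs ys →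
  count p xs * count q ys ≡ count (λ (x , y) → p x ∧ q y) (cartesianProduct xs ys)
count-* p q xs ys = begin
  count p xs * count q ys                               ≡⟨ sum-map-const (λ _ → refl) (filterᵇ p xs) ⟨
  sum (map (λ _ → count q ys) (filterᵇ p xs))           ≡⟨ sum-count-filterᵇ p (λ _ → q) xs ys ⟩
  count (λ (x , y) → p x ∧ q y) (cartesianProduct xs ys) ∎

count-cartesianProduct-∷ʳ : ∀ (r : A × B → Bool) xs y ys →
  count r (cartesianProduct xs (y ∷ ys)) ≡ count (λ x → r (x , y)) xs + count r (cartesianProduct xs ys)
count-cartesianProduct-∷ʳ r [] y ys = refl
count-cartesianProduct-∷ʳ r (x ∷ xs) y ys = begin
  count r (cartesianProduct (x ∷ xs) (y ∷ ys))
    ≡⟨ count-++ r ((x , y) ∷ []) _ ⟩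
  a + count r (map (x ,_) ys ++ cartesianProduct xs (y ∷ ys))
    ≡⟨ cong (a +_) (count-++ r (map (x ,_) ys) _) ⟩
  a + (b + count r (cartesianProduct xs (y ∷ ys)))
    ≡⟨ cong (λ n → a + (b + n)) (count-cartesianProduct-∷ʳ r xs y ys) ⟩
  a + (b + (count (λ x → r (x , y)) xs + count r (cartesianProduct xs ys)))
    ≡⟨ +-assoc a b _ ⟨
  a + b + (count (λ x → r (x , y)) xs + count r (cartesianProduct xs ys))
    ≡⟨ interchange a b _ _ ⟩
  a + count (λ x → r (x , y)) xs + (b + count r (cartesianProduct xs ys))
    ≡⟨ cong₂ _+_ (cong (_+ _) (sym (count-map r (_, y) (x ∷ [])))) (count-++ r (map (x ,_) ys) _) ⟨
  count (λ x → r (x , y)) (x ∷ []) + count (λ x → r (x , y)) xs + count r (cartesianProduct (x ∷ xs) ys)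
    ≡⟨ cong (_+ _) (count-++ (λ x → r (x , y)) (x ∷ []) xs) ⟨
  count (λ x → r (x , y)) (x ∷ xs) + count r (cartesianProduct (x ∷ xs) ys) ∎
  where
  a b : ℕ
  a = count r ((x , y) ∷ [])
  b = count r (map (x ,_) ys)

count-cartesianProduct-swap : ∀ (r : A × B → Bool) xs ys →
  count r (cartesianProduct xs ys) ≡ count (r ∘ swap) (cartesianProduct ys xs)
count-cartesianProduct-swap r [] ys = cong (count (r ∘ swap)) (sym (cartesianProductWith-zeroʳ _,_ ys))
count-cartesianProduct-swap r (x ∷ xs) ys = begin
  count r (map (x ,_) ys ++ cartesianProduct xs ys)                       ≡⟨ count-++ r (map (x ,_) ys) _ ⟩
  count r (map (x ,_) ys) + count r (cartesianProduct xs ys)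
    ≡⟨ cong₂ _+_ (count-map r (x ,_) ys) (count-cartesianProduct-swap r xs ys) ⟩
  count (λ y → r (x , y)) ys + count (r ∘ swap) (cartesianProduct ys xs) ≡⟨ count-cartesianProduct-∷ʳ (r ∘ swap) ys x xs ⟨
  count (r ∘ swap) (cartesianProduct ys (x ∷ xs))                         ∎

record Enumerates (_≟_ : DecidableEquality A) (xs : List A) : Set where
  constructor enumerates
  field
    once : ∀ a → count (λ x → does (x ≟ a)) xs ≡ 1
open Enumerates

count-unique-partner : ∀ (p : A → Bool) (q : A → B → Bool) xs ys → (∀ x → count (q x) ys ≡ 1) →
  count p xs ≡ count (λ (x , y) → p x ∧ q x y) (cartesianProduct xs ys)
count-unique-partner p q xs ys unique = begin
  count p xs                                         ≡⟨ *-identityʳ (count p xs) ⟨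
  count p xs * 1                                     ≡⟨ sum-map-const unique (filterᵇ p xs) ⟨
  sum (map (λ x → count (q x) ys) (filterᵇ p xs))   ≡⟨ sum-count-filterᵇ p q xs ys ⟩
  count (λ (x , y) → p x ∧ q x y) (cartesianProduct xs ys) ∎

count-bijection : ∀ {_≟ᴬ_ : DecidableEquality A} {_≟ᴮ_ : DecidableEquality B} {xs ys} →
  Enumerates _≟ᴬ_ xs → Enumerates _≟ᴮ_ ys →
  ∀ (p : A → Bool) (q : B → Bool) (f : A → B) (g : B → A) →
  (∀ x → T (p x) → T (q (f x)) × g (f x) ≡ x) →
  (∀ y → T (q y) → T (p (g y)) × f (g y) ≡ y) →
  count p xs ≡ count q ys
count-bijection {A = A} {B = B} {_≟ᴬ_ = _≟ᴬ_} {_≟ᴮ_} {xs} {ys} enum-xs enum-ys p q f g gf fg = begin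
  count p xs
    ≡⟨ count-unique-partner p (λ x y → does (y ≟ᴮ f x)) xs ys (once enum-ys ∘ f) ⟩
  count (λ (x , y) → p x ∧ does (y ≟ᴮ f x)) (cartesianProduct xs ys)
    ≡⟨ count-cong graph-symmetric (cartesianProduct xs ys) ⟩
  count (λ (x , y) → q y ∧ does (x ≟ᴬ g y)) (cartesianProduct xs ys)
    ≡⟨ count-cartesianProduct-swap _ xs ys ⟩
  count (λ (y , x) → q y ∧ does (x ≟ᴬ g y)) (cartesianProduct ys xs)
    ≡⟨ count-unique-partner q (λ y x → does (x ≟ᴬ g y)) ys xs (once enum-xs ∘ g) ⟨
  count q ys ∎
  where
  graph-symmetric : ∀ ((x , y) : A × B) → p x ∧ does (y ≟ᴮ f x) ≡ q y ∧ does (x ≟ᴬ g y)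
  graph-symmetric (x , y) = does-⇔ (mk⇔ forth back) (T? (p x) ×-dec (y ≟ᴮ f x)) (T? (q y) ×-dec (x ≟ᴬ g y))
    where
    forth : T (p x) × y ≡ f x → T (q y) × x ≡ g y
    forth (px , refl) = proj₁ (gf x px) , sym (proj₂ (gf x px))
    back : T (q y) × x ≡ g y → T (p x) × y ≡ f x
    back (qy , refl) = proj₁ (fg y qy) , sym (proj₂ (fg y qy))

cartesianProduct-enumerates : ∀ {_≟ᴬ_ : DecidableEquality A} {_≟ᴮ_ : DecidableEquality B} {xs ys} →
  Enumerates _≟ᴬ_ xs → Enumerates _≟ᴮ_ ys → Enumerates (×-≡-dec _≟ᴬ_ _≟ᴮ_) (cartesianProduct xs ys)
cartesianProduct-enumerates {A = A} {B = B} {_≟ᴬ_ = _≟ᴬ_} {_≟ᴮ_} {xs} {ys} enum-xs enum-ys = enumerates once-pair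
  where
  once-pair : ∀ ((a , b) : A × B) → count (λ t → does (×-≡-dec _≟ᴬ_ _≟ᴮ_ t (a , b))) (cartesianProduct xs ys) ≡ 1
  once-pair (a , b) = begin
    count (λ t → does (×-≡-dec _≟ᴬ_ _≟ᴮ_ t (a , b))) (cartesianProduct xs ys)
      ≡⟨ count-cong pair-test (cartesianProduct xs ys) ⟩
    count (λ (x , y) → does (x ≟ᴬ a) ∧ does (y ≟ᴮ b)) (cartesianProduct xs ys)
      ≡⟨ count-unique-partner (λ x → does (x ≟ᴬ a)) (λ _ y → does (y ≟ᴮ b)) xs ys (λ _ → once enum-ys b) ⟨
    count (λ x → does (x ≟ᴬ a)) xs
      ≡⟨ once enum-xs a ⟩
    1 ∎
    where
    pair-test : ∀ ((x , y) : A × B) → does (×-≡-dec _≟ᴬ_ _≟ᴮ_ (x , y) (a , b)) ≡ does (x ≟ᴬ a) ∧ does (y ≟ᴮ b)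
    pair-test (x , y) =
      does-⇔ (mk⇔ ,-injective (λ (p , q) → cong₂ _,_ p q)) (×-≡-dec _≟ᴬ_ _≟ᴮ_ (x , y) (a , b)) (x ≟ᴬ a ×-dec y ≟ᴮ b)

_≟ˢ_ : ∀ {m} → DecidableEquality (Subset m)
_≟ˢ_ = Vec-≡-dec _≟-Bool_

count-allSubsets : ∀ m (a : Subset m) → count (λ x → does (x ≟ˢ a)) (allSubsets m) ≡ 1
count-allSubsets zero [] = refl
count-allSubsets (suc m) (b ∷ a) = trans (count-doubled (allSubsets m)) (count-allSubsets m a)
  where
  equals : ∀ {n} → Subset n → Subset n → Bool
  equals a x = does (x ≟ˢ a)
  doubled : Subset m → List (Subset (suc m))
  doubled v = (false ∷ v) ∷ (true ∷ v) ∷ []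
  count-doubled-one : ∀ c v → count (equals (c ∷ a)) (doubled v) ≡ count (equals a) (v ∷ [])
  count-doubled-one false v = begin
    count (equals (false ∷ a)) (doubled v)
      ≡⟨ count-++ (equals (false ∷ a)) ((false ∷ v) ∷ []) ((true ∷ v) ∷ []) ⟩
    count (equals (false ∷ a)) ((false ∷ v) ∷ []) + count (equals (false ∷ a)) ((true ∷ v) ∷ [])
      ≡⟨ cong₂ _+_ (count-singleton (equals (false ∷ a)) (equals a) (false ∷ v) v refl)
                   (count-singleton (equals (false ∷ a)) (λ _ → false) (true ∷ v) v refl) ⟩
    count (equals a) (v ∷ []) + 0 ≡⟨ +-identityʳ _ ⟩
    count (equals a) (v ∷ [])     ∎
  count-doubled-one true v = trans (count-++ (equals (true ∷ a)) ((false ∷ v) ∷ []) ((true ∷ v) ∷ []))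
    (cong₂ _+_ (count-singleton (equals (true ∷ a)) (λ _ → false) (false ∷ v) v refl)
               (count-singleton (equals (true ∷ a)) (equals a) (true ∷ v) v refl))
  count-doubled : ∀ vs → count (equals (b ∷ a)) (concatMap doubled vs) ≡ count (equals a) vs
  count-doubled [] = refl
  count-doubled (v ∷ vs) = begin
    count (equals (b ∷ a)) (doubled v ++ concatMap doubled vs)
      ≡⟨ count-++ (equals (b ∷ a)) (doubled v) (concatMap doubled vs) ⟩
    count (equals (b ∷ a)) (doubled v) + count (equals (b ∷ a)) (concatMap doubled vs)
      ≡⟨ cong₂ _+_ (count-doubled-one b v) (count-doubled vs) ⟩
    count (equals a) (v ∷ []) + count (equals a) vs
      ≡⟨ count-++ (equals a) (v ∷ []) vs ⟨
    count (equals a) (v ∷ vs) ∎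

allSubsets-enumerates : ∀ m → Enumerates _≟ˢ_ (allSubsets m)
allSubsets-enumerates m = enumerates (count-allSubsets m)

T-not : ∀ {b} → T (not b) ⇔ (¬ T b)
T-not {true}  = mk⇔ (λ ()) (λ ¬t → ¬t _)
T-not {false} = mk⇔ (λ _ ()) _

T-∈ᵇ : ∀ {x : Fin m} {S} → T (x ∈ᵇ S) ⇔ x ∈ S
T-∈ᵇ {x = x} {S} = mk⇔ (lookup⇒[]= x S ∘ to T-≡) (from T-≡ ∘ []=⇒lookup)

T-∀ᵇ : ∀ {p : Fin m → Bool} → T (∀ᵇ p) ⇔ (∀ x → T (p x))
T-∀ᵇ {p = p} = mk⇔
  (λ h x → All.lookup (all⁺ p _ h) (∈-allFin x))
  (λ h → all⁻ p {xs = allFin _} (All.tabulate (λ {x} _ → h x)))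

T-∃ᵇ : ∀ {p : Fin m → Bool} → T (∃ᵇ p) ⇔ ∃ λ x → T (p x)
T-∃ᵇ {p = p} = mk⇔ (satisfied ∘ any⁻ p (allFin _)) (λ (x , px) → any⁺ p (lose {xs = allFin _} (∈-allFin x) px))

T-⊆ᵇ : ∀ {S R : Subset m} → T (S ⊆ᵇ R) ⇔ S ⊆ R
T-⊆ᵇ {S = S} {R} = mk⇔ ⇒ ⇐
  where
  ⇒ : T (S ⊆ᵇ R) → S ⊆ R
  ⇒ h {x} x∈S with to T-∨ (to T-∀ᵇ h x)
  ... | inj₁ x∉S = contradiction⊥ (to T-not x∉S (from T-∈ᵇ x∈S))
  ... | inj₂ x∈R = to T-∈ᵇ x∈R
  ⇐ : S ⊆ R → T (S ⊆ᵇ R)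
  ⇐ S⊆R = from T-∀ᵇ λ x → from T-∨ (test x (x ∈? S))
    where
    test : ∀ x → _ → T (not (x ∈ᵇ S)) ⊎ T (x ∈ᵇ R)
    test x (yes x∈S) = inj₂ (from T-∈ᵇ (S⊆R x∈S))
    test x (no x∉S)  = inj₁ (from T-not (x∉S ∘ to T-∈ᵇ))

∈-∖ : ∀ (S R : Subset m) {x} → x ∈ S ∖ R ⇔ (x ∈ S × x ∉ R)
∈-∖ S R = mk⇔ (λ h → let (x∈S , x∈∁R) = x∈p∩q⁻ S (∁ R) h in x∈S , x∈∁p⇒x∉p x∈∁R)
                      (λ (x∈S , x∉R) → x∈p∩q⁺ (x∈S , x∉p⇒x∈∁p x∉R))

∈-N : ∀ (K : Graph m) P {x} → x ∈ N K P ⇔ ∃ λ u → u ∈ P × T (E K u x)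
∈-N K P {x} = mk⇔
  (λ h → let (u , t) = to T-∃ᵇ (subst T (lookup∘tabulate _ x) (from T-∈ᵇ h)) ; (u∈P , e) = to T-∧ t
         in u , to T-∈ᵇ u∈P , e)
  (λ (u , u∈P , e) → to T-∈ᵇ (subst T (sym (lookup∘tabulate _ x)) (from T-∃ᵇ (u , from T-∧ (from T-∈ᵇ u∈P , e)))))

T-disjoint : ∀ {S Q : Subset m} → T ((S ∩ Q) ⊆ᵇ ⊥) ⇔ (∀ {x} → x ∈ S → x ∉ Q)
T-disjoint {S = S} {Q} = mk⇔
  (λ h {x} x∈S x∈Q → ∉⊥ (to T-⊆ᵇ h (x∈p∩q⁺ {x = x} (x∈S , x∈Q))))
  (λ h → from (T-⊆ᵇ {R = ⊥}) λ {x} x∈S∩Q → let (x∈S , x∈Q) = x∈p∩q⁻ S Q x∈S∩Q in contradiction⊥ (h x∈S x∈Q))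

Independent : Graph m → Subset m → Set
Independent K S = ∀ {x y} → x ∈ S → y ∈ S → ¬ T (E K x y)

T-isStable : ∀ {K : Graph m} {S} → T (isStable K S) ⇔ (S ⊆ V K × Independent K S)
T-isStable {m = m} {K = K} {S} = mk⇔ ⇒ ⇐
  where
  ⇒ : T (isStable K S) → S ⊆ V K × Independent K S
  ⇒ h = to T-⊆ᵇ (proj₁ (to T-∧ h)) , independent
    where
    independent : Independent K S
    independent {x} {y} x∈S y∈S e =
      to T-not (to T-∀ᵇ (to T-∀ᵇ (proj₂ (to T-∧ h)) x) y) (from T-∧ (from T-∈ᵇ x∈S , from T-∧ (from T-∈ᵇ y∈S , e)))
  ⇐ : S ⊆ V K × Independent K S → T (isStable K S)
  ⇐ (⊆V , independent) = from T-∧ (from (T-⊆ᵇ {S = S}) ⊆V , from T-∀ᵇ no-edge)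
    where
    adjacentIn : Fin m → Fin m → Bool
    adjacentIn x y = (x ∈ᵇ S) ∧ (y ∈ᵇ S) ∧ E K x y
    no-edge : ∀ x → T (∀ᵇ λ y → not (adjacentIn x y))
    no-edge x = from (T-∀ᵇ {p = λ y → not (adjacentIn x y)}) λ y → from T-not λ h →
      let (x∈S , rest) = to T-∧ h ; (y∈S , e) = to T-∧ rest in independent (to T-∈ᵇ x∈S) (to T-∈ᵇ y∈S) e

record MaximalStable (K : Graph m) (S : Subset m) : Set where
  field
    ⊆V          : S ⊆ V K
    independent : Independent K S
    dominating  : ∀ {v} → v ∈ V K → v ∉ S → ∃ λ y → y ∈ S × T (E K v y)

module _ {K : Graph m} (simple : IsSimpleGraph K) where
  open IsSimpleGraph simple

  insert-independent : ∀ {S v} → Independent K S → (∀ {y} → y ∈ S → ¬ T (E K v y)) → Independent K (S ∪ ⁅ v ⁆)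
  insert-independent {S} {v} ind isolated x∈ y∈ e with x∈p∪q⁻ S ⁅ v ⁆ x∈ | x∈p∪q⁻ S ⁅ v ⁆ y∈
  ... | inj₁ x∈S | inj₁ y∈S = ind x∈S y∈S e
  ... | inj₁ x∈S | inj₂ y∈v rewrite x∈⁅y⁆⇒x≡y v y∈v = isolated x∈S (subst T (symmetric _ v) e)
  ... | inj₂ x∈v | inj₁ y∈S rewrite x∈⁅y⁆⇒x≡y v x∈v = isolated y∈S e
  ... | inj₂ x∈v | inj₂ y∈v rewrite x∈⁅y⁆⇒x≡y v x∈v | x∈⁅y⁆⇒x≡y v y∈v = subst T (loopless v) e

  T-isMaximalStable : ∀ {S} → T (isMaximalStable K S) ⇔ MaximalStable K S
  T-isMaximalStable {S} = mk⇔ ⇒ ⇐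
    where
    ⇒ : T (isMaximalStable K S) → MaximalStable K S
    ⇒ h = record { ⊆V = ⊆V ; independent = ind ; dominating = dom }
      where
      ⊆V : S ⊆ V K
      ⊆V = proj₁ (to (T-isStable {K = K}) (proj₁ (to T-∧ h)))
      ind : Independent K S
      ind = proj₂ (to (T-isStable {K = K}) (proj₁ (to T-∧ h)))
      dom : ∀ {v} → v ∈ V K → v ∉ S → ∃ λ y → y ∈ S × T (E K v y)
      dom {v} v∈V v∉S with to T-∨ (to T-∀ᵇ (proj₂ (to T-∧ h)) v)
      ... | inj₁ t = contradiction⊥ (to T-not t (from T-∧ (from T-∈ᵇ v∈V , from T-not (v∉S ∘ to T-∈ᵇ))))
      ... | inj₂ t with T? (∃ᵇ (λ y → (y ∈ᵇ S) ∧ E K v y))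
      ...   | yes n = let (y , t′) = to T-∃ᵇ n ; (y∈S , e) = to T-∧ t′ in y , to T-∈ᵇ y∈S , e
      ...   | no ¬n = contradiction⊥ (to T-not t (from T-isStable (∪⊆V , insert-independent ind isolated)))
        where
        isolated : ∀ {y} → y ∈ S → ¬ T (E K v y)
        isolated {y} y∈S e = ¬n (from T-∃ᵇ (y , from T-∧ (from T-∈ᵇ y∈S , e)))
        ∪⊆V : S ∪ ⁅ v ⁆ ⊆ V K
        ∪⊆V x∈ with x∈p∪q⁻ S ⁅ v ⁆ x∈
        ... | inj₁ x∈S = ⊆V x∈S
        ... | inj₂ x∈v rewrite x∈⁅y⁆⇒x≡y v x∈v = v∈V
    ⇐ : MaximalStable K S → T (isMaximalStable K S)
    ⇐ ms = from T-∧ (from T-isStable (⊆V , independent) , from T-∀ᵇ candidate)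
      where
      open MaximalStable ms
      excluded : Fin m → Bool
      excluded v = not ((v ∈ᵇ V K) ∧ not (v ∈ᵇ S))
      candidate : ∀ v → T (excluded v ∨ not (isStable K (S ∪ ⁅ v ⁆)))
      candidate v with v ∈? V K | v ∈? S
      ... | no v∉V  | _      = from (T-∨ {excluded v}) (inj₁ (from T-not (v∉V ∘ to T-∈ᵇ ∘ proj₁ ∘ to T-∧)))
      ... | yes _   | yes v∈S = from (T-∨ {excluded v}) (inj₁ (from T-not λ t → to T-not (proj₂ (to T-∧ t)) (from T-∈ᵇ v∈S)))
      ... | yes v∈V | no v∉S  = from (T-∨ {excluded v}) (inj₂ (from T-not λ t →
            let (y , y∈S , e) = dominating v∈V v∉S in
            proj₂ (to (T-isStable {K = K}) t) (x∈p∪q⁺ (inj₂ (x∈⁅x⁆ v))) (x∈p∪q⁺ (inj₁ y∈S)) e))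

isMaximalStableWith : Graph m → Subset m → Subset m → Subset m → Bool
isMaximalStableWith K P Q S = isMaximalStable K S ∧ (P ⊆ᵇ S) ∧ ((S ∩ Q) ⊆ᵇ ⊥)

record MaximalStableWith (K : Graph m) (P Q S : Subset m) : Set where
  field
    maximalStable : MaximalStable K S
    contains      : P ⊆ S
    avoids        : ∀ {x} → x ∈ S → x ∉ Q
  open MaximalStable maximalStable public

T-isMaximalStableWith : ∀ {K : Graph m} {P Q S} → IsSimpleGraph K →
  T (isMaximalStableWith K P Q S) ⇔ MaximalStableWith K P Q S
T-isMaximalStableWith {P = P} {Q} {S} simple = mk⇔
  (λ h → let (ms , rest) = to T-∧ h ; (P⊆S , S∩Q) = to T-∧ rest in
    record { maximalStable = to (T-isMaximalStable simple) ms ; contains = to T-⊆ᵇ P⊆S ; avoids = to T-disjoint S∩Q })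
  (λ msw → let open MaximalStableWith msw in
    from T-∧ (from (T-isMaximalStable simple) maximalStable ,
              from T-∧ (from (T-⊆ᵇ {S = P}) contains , from (T-disjoint {S = S} {Q}) avoids)))

T-E-∖ᵛ : ∀ (K : Graph m) Γ {x y} → T (E (K ∖ᵛ Γ) x y) ⇔ (T (E K x y) × x ∉ Γ × y ∉ Γ)
T-E-∖ᵛ K Γ = mk⇔
  (λ h → let (e , rest) = to T-∧ h ; (x∉Γ , y∉Γ) = to T-∧ rest in e , to T-not x∉Γ ∘ from T-∈ᵇ , to T-not y∉Γ ∘ from T-∈ᵇ)
  (λ (e , x∉Γ , y∉Γ) → from T-∧ (e , from T-∧ (from T-not (x∉Γ ∘ to T-∈ᵇ) , from T-not (y∉Γ ∘ to T-∈ᵇ))))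

∖ᵛ-simple : ∀ {K : Graph m} {Γ} → IsSimpleGraph K → IsSimpleGraph (K ∖ᵛ Γ)
∖ᵛ-simple {K = K} {Γ} simple = record
  { edge-ends = λ x y e → let (e′ , x∉Γ , y∉Γ) = to (T-E-∖ᵛ K Γ) e ; (x∈V , y∈V) = edge-ends x y e′ in
      from T-∈ᵇ (from (∈-∖ (V K) Γ) (to T-∈ᵇ x∈V , x∉Γ)) , from T-∈ᵇ (from (∈-∖ (V K) Γ) (to T-∈ᵇ y∈V , y∉Γ))
  ; symmetric = λ x y → cong₂ _∧_ (symmetric x y) (∧-comm (not (x ∈ᵇ Γ)) (not (y ∈ᵇ Γ)))
  ; loopless = λ x → cong (_∧ _) (loopless x)
  }
  where open IsSimpleGraph simple

module Decomposition {G C H : Graph m} (decomposition : IsDecomposition G C H) where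

  ∈V-decomposition : ∀ {x} → x ∈ V G ⇔ (x ∈ V C ⊎ x ∈ V H)
  ∈V-decomposition {x} = mk⇔
    (λ x∈G → Sum.map (to T-∈ᵇ) (to T-∈ᵇ) (to T-∨ (subst T (proj₁ decomposition x) (from T-∈ᵇ x∈G))))
    (λ x∈C⊎H → to T-∈ᵇ (subst T (sym (proj₁ decomposition x)) (from T-∨ (Sum.map (from T-∈ᵇ) (from T-∈ᵇ) x∈C⊎H))))

  T-E-decomposition : ∀ {x y} → T (E G x y) ⇔ (T (E C x y) ⊎ T (E H x y))
  T-E-decomposition {x} {y} = mk⇔
    (to T-∨ ∘ subst T (proj₁ (proj₂ decomposition) x y))
    (subst T (sym (proj₁ (proj₂ decomposition) x y)) ∘ from T-∨)

decomposition-swap : ∀ {G C H : Graph m} → IsDecomposition G C H → IsDecomposition G H C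
decomposition-swap {C = C} {H} (V≡ , E≡ , disjoint) =
    (λ x → trans (V≡ x) (∨-comm (x ∈ᵇ V C) (x ∈ᵇ V H)))
  , (λ x y → trans (E≡ x y) (∨-comm (E C x y) (E H x y)))
  , (λ x y eH eC → disjoint x y eC eH)

undominated : Graph m → Subset m → Subset m → Subset m
undominated K I S = (I ∖ S) ∖ N K S

∈-undominated : ∀ (K : Graph m) I S {x} → x ∈ undominated K I S ⇔ (x ∈ I × x ∉ S × x ∉ N K S)
∈-undominated K I S = mk⇔
  (λ h → let (x∈I∖S , x∉N) = to (∈-∖ (I ∖ S) (N K S)) h ; (x∈I , x∉S) = to (∈-∖ I S) x∈I∖S in x∈I , x∉S , x∉N)
  (λ (x∈I , x∉S , x∉N) → from (∈-∖ (I ∖ S) (N K S)) (from (∈-∖ I S) (x∈I , x∉S) , x∉N))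

Side : Subset m → Graph m → (X Θ Γ SK : Subset m) → Set
Side I K X Θ Γ SK = MaximalStableWith (K ∖ᵛ Γ) (X ∪ Θ) ((I ∖ Θ) ∪ N K Γ) SK

module Part {G K K' : Graph m} (simple-K : IsSimpleGraph K) (simple-K' : IsSimpleGraph K')
  (decomposition : IsDecomposition G K K') {I : Subset m} (∈I : ∀ {x} → x ∈ I ⇔ (x ∈ V K × x ∈ V K')) where

  open Decomposition {G = G} {K} {K'} decomposition

  K-edge : ∀ {x y} → T (E K x y) → T (E G x y)
  K-edge = from T-E-decomposition ∘ inj₁

  K'-edge : ∀ {x y} → T (E K' x y) → T (E G x y)
  K'-edge = from T-E-decomposition ∘ inj₂

  K-symmetric : ∀ {x y} → T (E K x y) → T (E K y x)
  K-symmetric {x} {y} = subst T (IsSimpleGraph.symmetric simple-K x y)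

  K'-symmetric : ∀ {x y} → T (E K' x y) → T (E K' y x)
  K'-symmetric {x} {y} = subst T (IsSimpleGraph.symmetric simple-K' x y)

  K-source : ∀ {x y} → T (E K x y) → x ∈ V K
  K-source {x} {y} = to T-∈ᵇ ∘ proj₁ ∘ IsSimpleGraph.edge-ends simple-K x y

  K-target : ∀ {x y} → T (E K x y) → y ∈ V K
  K-target {x} {y} = to T-∈ᵇ ∘ proj₂ ∘ IsSimpleGraph.edge-ends simple-K x y

  K'-source : ∀ {x y} → T (E K' x y) → x ∈ V K'
  K'-source {x} {y} = to T-∈ᵇ ∘ proj₁ ∘ IsSimpleGraph.edge-ends simple-K' x y

  module Forward {S} (maximal : MaximalStable G S) where
    open MaximalStable maximal

    Γ : Subset m
    Γ = undominated K I S

    restriction-maximal : MaximalStable (K ∖ᵛ Γ) (S ∩ V K)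
    restriction-maximal = record
      { ⊆V = λ x∈ → let (x∈S , x∈K) = x∈p∩q⁻ S (V K) x∈ in
          from (∈-∖ (V K) Γ) (x∈K , λ x∈Γ → proj₁ (proj₂ (to (∈-undominated K I S) x∈Γ)) x∈S)
      ; independent = λ x∈ y∈ e → independent (proj₁ (x∈p∩q⁻ S (V K) x∈)) (proj₁ (x∈p∩q⁻ S (V K) y∈))
          (K-edge (proj₁ (to (T-E-∖ᵛ K Γ) e)))
      ; dominating = dominated
      }
      where
      dominated : ∀ {v} → v ∈ V (K ∖ᵛ Γ) → v ∉ S ∩ V K → ∃ λ y → y ∈ S ∩ V K × T (E (K ∖ᵛ Γ) v y)
      dominated {v} v∈ v∉ with to (∈-∖ (V K) Γ) v∈ | v ∈? N K S
      ... | v∈K , v∉Γ | yes v∈N =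
        let (u , u∈S , e) = to (∈-N K S) v∈N
            u∉Γ = λ u∈Γ → proj₁ (proj₂ (to (∈-undominated K I S) u∈Γ)) u∈S
        in u , x∈p∩q⁺ (u∈S , K-source e) , from (T-E-∖ᵛ K Γ) (K-symmetric e , v∉Γ , u∉Γ)
      ... | v∈K , v∉Γ | no v∉N with dominating (from ∈V-decomposition (inj₁ v∈K)) (λ v∈S → v∉ (x∈p∩q⁺ (v∈S , v∈K)))
      ...   | y , y∈S , e with to T-E-decomposition e
      ...     | inj₁ eK  = contradiction⊥ (v∉N (from (∈-N K S) (y , y∈S , K-symmetric eK)))
      ...     | inj₂ eK' = contradiction⊥ (v∉Γ (from (∈-undominated K I S)
                  (from ∈I (v∈K , K'-source eK') , (λ v∈S → v∉ (x∈p∩q⁺ (v∈S , v∈K))) , v∉N)))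

    side : ∀ {X} → X ⊆ S → X ⊆ V K → Side I K X (S ∩ I) Γ (S ∩ V K)
    side {X} X⊆S X⊆K = record { maximalStable = restriction-maximal ; contains = contains ; avoids = avoids }
      where
      contains : X ∪ (S ∩ I) ⊆ S ∩ V K
      contains x∈ with x∈p∪q⁻ X (S ∩ I) x∈
      ... | inj₁ x∈X   = x∈p∩q⁺ (X⊆S x∈X , X⊆K x∈X)
      ... | inj₂ x∈S∩I = let (x∈S , x∈I) = x∈p∩q⁻ S I x∈S∩I in x∈p∩q⁺ (x∈S , proj₁ (to ∈I x∈I))
      avoids : ∀ {x} → x ∈ S ∩ V K → x ∉ (I ∖ (S ∩ I)) ∪ N K Γ
      avoids {x} x∈ x∈Q with x∈p∩q⁻ S (V K) x∈ | x∈p∪q⁻ (I ∖ (S ∩ I)) (N K Γ) x∈Q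
      ... | x∈S , _ | inj₁ x∈I∖Θ = let (x∈I , x∉Θ) = to (∈-∖ I (S ∩ I)) x∈I∖Θ in x∉Θ (x∈p∩q⁺ (x∈S , x∈I))
      ... | x∈S , _ | inj₂ x∈NΓ =
        let (u , u∈Γ , e) = to (∈-N K Γ) x∈NΓ in
        proj₂ (proj₂ (to (∈-undominated K I S) u∈Γ)) (from (∈-N K S) (x , x∈S , K-symmetric e))

    undominated-disjoint : ∀ {x} → x ∈ Γ → x ∉ undominated K' I S
    undominated-disjoint x∈Γ x∈Γ' with to (∈-undominated K I S) x∈Γ | to (∈-undominated K' I S) x∈Γ'
    ... | x∈I , x∉S , x∉NK | _ , _ , x∉NK' with dominating (from ∈V-decomposition (inj₁ (proj₁ (to ∈I x∈I)))) x∉S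
    ...   | y , y∈S , e with to T-E-decomposition e
    ...     | inj₁ eK  = x∉NK (from (∈-N K S) (y , y∈S , K-symmetric eK))
    ...     | inj₂ eK' = x∉NK' (from (∈-N K' S) (y , y∈S , K'-symmetric eK'))

  -- S is given by its members so that the module also serves the swapped decomposition, where S = SK' ∪ SK.
  module Backward {X X' Θ Γ SK Ψ SK' S : Subset m} (∈S : ∀ {x} → x ∈ S ⇔ (x ∈ SK ⊎ x ∈ SK'))
    (Θ⊆I : Θ ⊆ I) (Γ⊆I∖Θ : Γ ⊆ I ∖ Θ) (Γ∩Ψ : ∀ {x} → x ∈ Γ → x ∉ Ψ)
    (sideK : Side I K X Θ Γ SK) (sideK' : Side I K' X' Θ Ψ SK') where

    private
      module SK = MaximalStableWith sideK
      module SK' = MaximalStableWith sideK'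

    common⊆Θ : ∀ {x} → x ∈ SK ⊎ x ∈ SK' → x ∈ I → x ∈ Θ
    common⊆Θ {x} x∈ x∈I = decidable-stable (x ∈? Θ) λ x∉Θ →
      let x∈I∖Θ = from (∈-∖ I Θ) (x∈I , x∉Θ) in
      Sum.[ (λ x∈SK → SK.avoids x∈SK (x∈p∪q⁺ (inj₁ x∈I∖Θ))) , (λ x∈SK' → SK'.avoids x∈SK' (x∈p∪q⁺ (inj₁ x∈I∖Θ))) ] x∈

    SK∌Γ : ∀ {x} → x ∈ SK → x ∉ Γ
    SK∌Γ = proj₂ ∘ to (∈-∖ (V K) Γ) ∘ SK.⊆V

    S∩K⊆SK : ∀ {x} → x ∈ S → x ∈ V K → x ∈ SK
    S∩K⊆SK x∈S x∈K with to ∈S x∈S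
    ... | inj₁ x∈SK  = x∈SK
    ... | inj₂ x∈SK' = SK.contains (x∈p∪q⁺ (inj₂ (common⊆Θ (inj₂ x∈SK')
                          (from ∈I (x∈K , proj₁ (to (∈-∖ (V K') Ψ) (SK'.⊆V x∈SK')))))))

    S∩K≡SK : S ∩ V K ≡ SK
    S∩K≡SK = ⊆-antisym
      (λ x∈ → let (x∈S , x∈K) = x∈p∩q⁻ S (V K) x∈ in S∩K⊆SK x∈S x∈K)
      (λ x∈SK → x∈p∩q⁺ (from ∈S (inj₁ x∈SK) , proj₁ (to (∈-∖ (V K) Γ) (SK.⊆V x∈SK))))

    S∩I≡Θ : S ∩ I ≡ Θ
    S∩I≡Θ = ⊆-antisym
      (λ x∈ → let (x∈S , x∈I) = x∈p∩q⁻ S I x∈ in common⊆Θ (to ∈S x∈S) x∈I)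
      (λ x∈Θ → x∈p∩q⁺ (from ∈S (inj₁ (SK.contains (x∈p∪q⁺ (inj₂ x∈Θ)))) , Θ⊆I x∈Θ))

    independent : ∀ {x y} → x ∈ S → y ∈ S → ¬ T (E K x y)
    independent x∈S y∈S e =
      SK.independent (S∩K⊆SK x∈S (K-source e)) (S∩K⊆SK y∈S (K-target e))
        (from (T-E-∖ᵛ K Γ) (e , SK∌Γ (S∩K⊆SK x∈S (K-source e)) , SK∌Γ (S∩K⊆SK y∈S (K-target e))))

    dominating : ∀ {v} → v ∈ V K → v ∉ S → ∃ λ y → y ∈ S × T (E G v y)
    dominating {v} v∈K v∉S with v ∈? Γ
    ... | no v∉Γ =
      let (y , y∈SK , e) = SK.dominating (from (∈-∖ (V K) Γ) (v∈K , v∉Γ)) (v∉S ∘ from ∈S ∘ inj₁) in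
      y , from ∈S (inj₁ y∈SK) , K-edge (proj₁ (to (T-E-∖ᵛ K Γ) e))
    ... | yes v∈Γ =
      let v∈K' = proj₂ (to ∈I (proj₁ (to (∈-∖ I Θ) (Γ⊆I∖Θ v∈Γ))))
          (y , y∈SK' , e) = SK'.dominating (from (∈-∖ (V K') Ψ) (v∈K' , Γ∩Ψ v∈Γ)) (v∉S ∘ from ∈S ∘ inj₂) in
      y , from ∈S (inj₂ y∈SK') , K'-edge (proj₁ (to (T-E-∖ᵛ K' Ψ) e))

    undominated≡Γ : undominated K I S ≡ Γ
    undominated≡Γ = ⊆-antisym ⊆Γ ⊇Γ
      where
      ⊆Γ : undominated K I S ⊆ Γ
      ⊆Γ {x} x∈ = let (x∈I , x∉S , x∉N) = to (∈-undominated K I S) x∈ in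
        decidable-stable (x ∈? Γ) λ x∉Γ →
          let (y , y∈SK , e) = SK.dominating (from (∈-∖ (V K) Γ) (proj₁ (to ∈I x∈I) , x∉Γ)) (x∉S ∘ from ∈S ∘ inj₁) in
          x∉N (from (∈-N K S) (y , from ∈S (inj₁ y∈SK) , K-symmetric (proj₁ (to (T-E-∖ᵛ K Γ) e))))
      ⊇Γ : Γ ⊆ undominated K I S
      ⊇Γ {x} x∈Γ = from (∈-undominated K I S) (x∈I , x∉S , x∉N)
        where
        x∈I : x ∈ I
        x∈I = proj₁ (to (∈-∖ I Θ) (Γ⊆I∖Θ x∈Γ))
        x∉S : x ∉ S
        x∉S x∈S with to ∈S x∈S
        ... | inj₁ x∈SK  = SK∌Γ x∈SK x∈Γ
        ... | inj₂ x∈SK' = proj₂ (to (∈-∖ I Θ) (Γ⊆I∖Θ x∈Γ)) (common⊆Θ (inj₂ x∈SK') x∈I)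
        x∉N : x ∉ N K S
        x∉N x∈N = let (u , u∈S , e) = to (∈-N K S) x∈N in
          SK.avoids (S∩K⊆SK u∈S (K-source e)) (x∈p∪q⁺ (inj₂ (from (∈-N K Γ) (x , x∈Γ , K-symmetric e))))

undominated⊆ : ∀ (K : Graph m) I S → undominated K I S ⊆ I ∖ (S ∩ I)
undominated⊆ K I S x∈ = let (x∈I , x∉S , _) = to (∈-undominated K I S) x∈ in
  from (∈-∖ I (S ∩ I)) (x∈I , x∉S ∘ proj₁ ∘ x∈p∩q⁻ S I)

restrictions-cover : ∀ {G C H : Graph m} → IsDecomposition G C H → ∀ {S} → S ⊆ V G → (S ∩ V C) ∪ (S ∩ V H) ≡ S
restrictions-cover {G = G} {C} {H} decomposition {S} S⊆G = ⊆-antisym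
  (λ x∈ → Sum.[ proj₁ ∘ x∈p∩q⁻ S (V C) , proj₁ ∘ x∈p∩q⁻ S (V H) ] (x∈p∪q⁻ (S ∩ V C) (S ∩ V H) x∈))
  (λ x∈S → x∈p∪q⁺ (Sum.map (λ x∈C → x∈p∩q⁺ (x∈S , x∈C)) (λ x∈H → x∈p∩q⁺ (x∈S , x∈H)) (to ∈V-decomposition (S⊆G x∈S))))
  where open Decomposition {G = G} {C} {H} decomposition

module Splitting {m} {G C H : Graph m} (simple-G : IsSimpleGraph G) (simple-C : IsSimpleGraph C) (simple-H : IsSimpleGraph H)
  (decomposition : IsDecomposition G C H) {XC XH : Subset m} (XC⊆C : XC ⊆ V C) (XH⊆H : XH ⊆ V H) where

  I : Subset m
  I = common C H

  module PartC = Part {G = G} simple-C simple-H decomposition ∩⇔×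
  module PartH = Part {G = G} simple-H simple-C (decomposition-swap {G = G} {C} {H} decomposition)
                      (mk⇔ (swap ∘ to ∩⇔×) (from ∩⇔× ∘ swap))

  Tuple : Set
  Tuple = Subset m × Subset m × Subset m × Subset m × Subset m

  C-sideᵇ : (Θ Γ SC : Subset m) → Bool
  C-sideᵇ Θ Γ SC = isMaximalStableWith (C ∖ᵛ Γ) (XC ∪ Θ) ((I ∖ Θ) ∪ N C Γ) SC

  H-sideᵇ : (Θ Γ : Subset m) → Subset m × Subset m → Bool
  H-sideᵇ Θ Γ (Ψ , SH) = (Ψ ⊆ᵇ ((I ∖ Θ) ∖ Γ)) ∧ isMaximalStableWith (H ∖ᵛ Ψ) (XH ∪ Θ) ((I ∖ Θ) ∪ N H Ψ) SH

  -- Nested exactly like the sums in rhs, so that rhs-count is bookkeeping with sum-count-filterᵇ and count-*.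
  isSplit : Tuple → Bool
  isSplit (Θ , Γ , SC , Ψ , SH) = (Θ ⊆ᵇ I) ∧ ((Γ ⊆ᵇ (I ∖ Θ)) ∧ (C-sideᵇ Θ Γ SC ∧ H-sideᵇ Θ Γ (Ψ , SH)))

  subsets : List (Subset m)
  subsets = allSubsets m

  tuples : List Tuple
  tuples = cartesianProduct subsets (cartesianProduct subsets (cartesianProduct subsets (cartesianProduct subsets subsets)))

  _≟ᵗ_ : DecidableEquality Tuple
  _≟ᵗ_ = ×-≡-dec _≟ˢ_ (×-≡-dec _≟ˢ_ (×-≡-dec _≟ˢ_ (×-≡-dec _≟ˢ_ _≟ˢ_)))

  tuples-enumerated : Enumerates _≟ᵗ_ tuples
  tuples-enumerated =
    cartesianProduct-enumerates all (cartesianProduct-enumerates all (cartesianProduct-enumerates all (cartesianProduct-enumerates all all)))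
    where
    all : Enumerates _≟ˢ_ subsets
    all = allSubsets-enumerates m

  rhs-count : rhs C H XC XH ≡ count isSplit tuples
  rhs-count = trans (cong sum (map-cong level₂ (filterᵇ (_⊆ᵇ I) subsets))) (sum-count-filterᵇ _ _ subsets _)
    where
    level₃ : ∀ Θ Γ →
      w[ C ∖ᵛ Γ ] (XC ∪ Θ) ((I ∖ Θ) ∪ N C Γ) * ΣSub ((I ∖ Θ) ∖ Γ) (λ Ψ → w[ H ∖ᵛ Ψ ] (XH ∪ Θ) ((I ∖ Θ) ∪ N H Ψ))
      ≡ count (λ (SC , rest) → C-sideᵇ Θ Γ SC ∧ H-sideᵇ Θ Γ rest) (cartesianProduct subsets (cartesianProduct subsets subsets))
    level₃ Θ Γ = trans
      (cong (w[ C ∖ᵛ Γ ] (XC ∪ Θ) ((I ∖ Θ) ∪ N C Γ) *_) (sum-count-filterᵇ _ _ subsets subsets))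
      (count-* (C-sideᵇ Θ Γ) (H-sideᵇ Θ Γ) subsets _)
    level₂ : ∀ Θ →
      ΣSub (I ∖ Θ) (λ Γ → w[ C ∖ᵛ Γ ] (XC ∪ Θ) ((I ∖ Θ) ∪ N C Γ) * ΣSub ((I ∖ Θ) ∖ Γ) (λ Ψ → w[ H ∖ᵛ Ψ ] (XH ∪ Θ) ((I ∖ Θ) ∪ N H Ψ)))
      ≡ count (λ (Γ , SC , rest) → (Γ ⊆ᵇ (I ∖ Θ)) ∧ (C-sideᵇ Θ Γ SC ∧ H-sideᵇ Θ Γ rest))
              (cartesianProduct subsets (cartesianProduct subsets (cartesianProduct subsets subsets)))
    level₂ Θ = trans (cong sum (map-cong (level₃ Θ) (filterᵇ (_⊆ᵇ (I ∖ Θ)) subsets))) (sum-count-filterᵇ _ _ subsets _)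

  record Split (Θ Γ SC Ψ SH : Subset m) : Set where
    field
      Θ⊆I    : Θ ⊆ I
      Γ⊆I∖Θ  : Γ ⊆ I ∖ Θ
      C-side : Side I C XC Θ Γ SC
      Ψ⊆I∖Θ∖Γ : Ψ ⊆ (I ∖ Θ) ∖ Γ
      H-side : Side I H XH Θ Ψ SH

  T-isSplit : ∀ {Θ Γ SC Ψ SH} → T (isSplit (Θ , Γ , SC , Ψ , SH)) ⇔ Split Θ Γ SC Ψ SH
  T-isSplit {Θ} {Γ} {SC} {Ψ} {SH} = mk⇔
    (λ h → let (a , h₁) = to T-∧ h ; (b , h₂) = to T-∧ h₁ ; (c , h₃) = to T-∧ h₂ ; (d , e) = to T-∧ h₃ in
      record { Θ⊆I = to T-⊆ᵇ a ; Γ⊆I∖Θ = to T-⊆ᵇ b ; C-side = to (T-isMaximalStableWith (∖ᵛ-simple simple-C)) c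
             ; Ψ⊆I∖Θ∖Γ = to T-⊆ᵇ d ; H-side = to (T-isMaximalStableWith (∖ᵛ-simple simple-H)) e })
    (λ s → let open Split s in
      from T-∧ (from (T-⊆ᵇ {S = Θ}) Θ⊆I , from T-∧ (from (T-⊆ᵇ {S = Γ}) Γ⊆I∖Θ ,
        from T-∧ (from (T-isMaximalStableWith (∖ᵛ-simple simple-C)) C-side , from T-∧ (from (T-⊆ᵇ {S = Ψ}) Ψ⊆I∖Θ∖Γ ,
          from (T-isMaximalStableWith (∖ᵛ-simple simple-H)) H-side)))))

  split : Subset m → Tuple
  split S = S ∩ I , undominated C I S , S ∩ V C , undominated H I S , S ∩ V H

  merge : Tuple → Subset m
  merge (_ , _ , SC , _ , SH) = SC ∪ SH

  counted : Subset m → Bool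
  counted = isMaximalStableWith G (XC ∪ XH) ⊥

  T-counted : ∀ {S} → T (counted S) ⇔ MaximalStableWith G (XC ∪ XH) ⊥ S
  T-counted {S} = T-isMaximalStableWith {P = XC ∪ XH} {⊥} {S} simple-G

  split-forward : ∀ S → T (counted S) → T (isSplit (split S)) × merge (split S) ≡ S
  split-forward S h = from T-isSplit split-S , restrictions-cover {G = G} {C} {H} decomposition ⊆V
    where
    open MaximalStableWith (to (T-counted {S}) h)
    split-S : Split (S ∩ I) (undominated C I S) (S ∩ V C) (undominated H I S) (S ∩ V H)
    split-S = record
      { Θ⊆I = proj₂ ∘ x∈p∩q⁻ S I
      ; Γ⊆I∖Θ = undominated⊆ C I S
      ; C-side = PartC.Forward.side maximalStable (contains ∘ x∈p∪q⁺ ∘ inj₁) XC⊆C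
      ; Ψ⊆I∖Θ∖Γ = λ x∈Ψ → from (∈-∖ (I ∖ (S ∩ I)) (undominated C I S))
          (undominated⊆ H I S x∈Ψ , PartH.Forward.undominated-disjoint maximalStable x∈Ψ)
      ; H-side = PartH.Forward.side maximalStable (contains ∘ x∈p∪q⁺ ∘ inj₂) XH⊆H
      }

  merge-backward : ∀ t → T (isSplit t) → T (counted (merge t)) × split (merge t) ≡ t
  merge-backward (Θ , Γ , SC , Ψ , SH) h =
    from (T-counted {SC ∪ SH}) witness ,
    cong₂ _,_ B.S∩I≡Θ (cong₂ _,_ B.undominated≡Γ (cong₂ _,_ B.S∩K≡SK
      (cong₂ _,_ B′.undominated≡Γ B′.S∩K≡SK)))
    where
    open Split (to (T-isSplit {Θ} {Γ} {SC} {Ψ} {SH}) h)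
    Ψ⊆I∖Θ : Ψ ⊆ I ∖ Θ
    Ψ⊆I∖Θ = proj₁ ∘ to (∈-∖ (I ∖ Θ) Γ) ∘ Ψ⊆I∖Θ∖Γ
    Ψ∩Γ : ∀ {x} → x ∈ Ψ → x ∉ Γ
    Ψ∩Γ = proj₂ ∘ to (∈-∖ (I ∖ Θ) Γ) ∘ Ψ⊆I∖Θ∖Γ
    module B = PartC.Backward ∪⇔⊎ Θ⊆I Γ⊆I∖Θ (λ x∈Γ x∈Ψ → Ψ∩Γ x∈Ψ x∈Γ) C-side H-side
    module B′ = PartH.Backward (mk⇔ (Sum.swap ∘ to ∪⇔⊎) (from ∪⇔⊎ ∘ Sum.swap)) Θ⊆I Ψ⊆I∖Θ Ψ∩Γ H-side C-side
    witness : MaximalStableWith G (XC ∪ XH) ⊥ (SC ∪ SH)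
    witness = record
      { maximalStable = record
        { ⊆V = λ x∈ → from ∈V-decomposition (Sum.map (side-⊆V C-side) (side-⊆V H-side) (x∈p∪q⁻ SC SH x∈))
        ; independent = λ x∈ y∈ e → Sum.[ B.independent x∈ y∈ , B′.independent x∈ y∈ ] (to T-E-decomposition e)
        ; dominating = λ v∈G v∉ →
            Sum.[ (λ v∈C → B.dominating v∈C v∉) , (λ v∈H → B′.dominating v∈H v∉) ] (to ∈V-decomposition v∈G)
        }
      ; contains = λ x∈ → x∈p∪q⁺ (Sum.map (side-contains C-side) (side-contains H-side) (x∈p∪q⁻ XC XH x∈))
      ; avoids = λ _ → ∉⊥
      }
      where
      open Decomposition {G = G} {C} {H} decomposition
      side-⊆V : ∀ {K X Θ Γ SK x} → Side I K X Θ Γ SK → x ∈ SK → x ∈ V K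
      side-⊆V {K} {Γ = Γ} side = proj₁ ∘ to (∈-∖ (V K) Γ) ∘ MaximalStableWith.⊆V side
      side-contains : ∀ {K X Θ Γ SK x} → Side I K X Θ Γ SK → x ∈ X → x ∈ SK
      side-contains side = MaximalStableWith.contains side ∘ x∈p∪q⁺ ∘ inj₁

  maximal-stable-count : w[ G ] (XC ∪ XH) ⊥ ≡ rhs C H XC XH
  maximal-stable-count = trans
    (count-bijection (allSubsets-enumerates m) tuples-enumerated counted isSplit split merge split-forward merge-backward)
    (sym rhs-count)

⁅⁆⊆ : ∀ {m} {S : Subset m} {x} → x ∈ S → ⁅ x ⁆ ⊆ S
⁅⁆⊆ {x = x} x∈S y∈ = subst (_∈ _) (sym (x∈⁅y⁆⇒x≡y x y∈)) x∈S

lemma3p5 : (m : ℕ) (G C H : Graph m)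
    → IsSimpleGraph G → IsSimpleGraph C → IsSimpleGraph H
    → IsDecomposition G C H
    → BipartiteWithClass G (common C H)
    → (∀ v → T (v ∈ᵇ common C H) → TwoLayered G v)
    → (∀ v → T (v ∈ᵇ common C H) → ∃ λ u → T (E C v u))
    → (∀ v → T (v ∈ᵇ common C H) → ∃ λ u → T (E H v u))
    → (b a : Fin m)
    → T (b ∈ᵇ V C) → T (not (b ∈ᵇ common C H))
    → T (a ∈ᵇ common C H)
    → (wAll G ≡ rhs C H ⊥ ⊥)
      × (wAt G b ≡ rhs C H ⁅ b ⁆ ⊥)
      × (wAt G a ≡ rhs C H ⁅ a ⁆ ⁅ a ⁆)
lemma3p5 m G C H simple-G simple-C simple-H decomposition _ _ _ _ b a b∈C _ a∈I =
    trans (cong (λ P → w[ G ] P ⊥) (sym (∪-identityʳ ⊥))) (count-identity ⊥⊆ ⊥⊆)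
  , trans (cong (λ P → w[ G ] P ⊥) (sym (∪-identityʳ ⁅ b ⁆))) (count-identity (⁅⁆⊆ (to T-∈ᵇ b∈C)) ⊥⊆)
  , trans (cong (λ P → w[ G ] P ⊥) (sym (∪-idem ⁅ a ⁆))) (count-identity (⁅⁆⊆ a∈C) (⁅⁆⊆ a∈H))
  where
  count-identity : ∀ {XC XH} → XC ⊆ V C → XH ⊆ V H → w[ G ] (XC ∪ XH) ⊥ ≡ rhs C H XC XH
  count-identity = Splitting.maximal-stable-count simple-G simple-C simple-H decomposition
  a∈C : a ∈ V C
  a∈C = proj₁ (to (∩⇔× {p = V C}) (to T-∈ᵇ a∈I))
  a∈H : a ∈ V H
  a∈H = proj₂ (to (∩⇔× {p = V C}) (to T-∈ᵇ a∈I))
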